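{- Let $\vdash$ be a regular entailment relation for an ordered group $G$, let $x\in G$, and for $y\in G$ define the relation $\vdash_y$ on $\mathrm{P}_{\mathrm{fe}}^*(G)$ by $A\vdash_y B$ iff there is an integer $p\ge0$ such that $A,A+py\vdash B$. If $A\vdash_x B$ and $A\vdash_{ -x}B$, then $A\vdash B$.
   Context: Groups are commutative; an ordered group is a commutative group with a partial order $\le_G$ compatible with addition. $\mathrm{P}_{\mathrm{fe}}^*(G)$ is the set of nonempty finite subsets of $G$; $a$ stands for $\{a\}$, $A,A'$ for $A\cup A'$, $x+A=\{x+a:a\in A\}$. An unbounded entailment relation on $G$ is a relation $\vdash$ on $\mathrm{P}_{\mathrm{fe}}^*(G)$ with: $a\vdash a$; $A\vdash B\Rightarrow A,A'\vdash B,B'$; ($A\vdash B,c$ and $A,c\vdash B$) $\Rightarrow A\vdash B$. It is regular if moreover $a\le_G b\Rightarrow a\vdash b$; $A\vdash B\Rightarrow x+A\vdash x+B$ for all $x\in G$; and $x+a,y+b\vdash y+a,x+b$ for all $a,b,x,y\in G$. -}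

module Defs where

open import Level using (Level; _⊔_; suc)
open import Data.Nat using (ℕ; zero; suc)
open import Data.List.NonEmpty using (List⁺; [_]; _∷_; toList; map; _⁺++⁺_)
open import Data.List.Membership.Propositional using (_∈_)
open import Data.Product using (Σ; _×_)
open import Relation.Binary.PropositionalEquality using (_≡_)
open import Relation.Binary.Structures using (IsPartialOrder)
open import Algebra.Structures using (IsAbelianGroup)

record OrderedGroup (c ℓ : Level) : Set (Level.suc (c ⊔ ℓ)) where
  infixl 6 _+_
  infix 4 _≤_
  field
    Carrier   : Set c
    _+_       : Carrier → Carrier → Carrier
    0#        : Carrier
    -_        : Carrier → Carrier
    _≤_       : Carrier → Carrier → Set ℓ
    isAbelianGroup : IsAbelianGroup _≡_ _+_ 0# -_
    isPartialOrder : IsPartialOrder _≡_ _≤_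
    +-mono-≤  : ∀ {a b} c → a ≤ b → a + c ≤ b + c

module _ {c ℓ : Level} (G : OrderedGroup c ℓ) where
  open OrderedGroup G

  -- Nonempty finite subsets of G are represented by nonempty lists; a relation
  -- on them is only considered through membership (see weakening below).
  Fe : Set c
  Fe = List⁺ Carrier

  _⊆_ : Fe → Fe → Set c
  A ⊆ B = ∀ {a} → a ∈ toList A → a ∈ toList B

  _+ˢ_ : Carrier → Fe → Fe
  x +ˢ A = map (x +_) A

  _·_ : ℕ → Carrier → Carrier
  zero · y = 0#
  suc p · y = y + (p · y)

  record IsEntailment {r : Level} (_⊢_ : Fe → Fe → Set r) : Set (c ⊔ r) where
    field
      reflexivity : ∀ a → [ a ] ⊢ [ a ]
      -- A ⊢ B ⇒ A,A' ⊢ B,B'  (stated for arbitrary supersets, i.e. set unions)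
      monotonicity : ∀ {A A' B B'} → A ⊆ A' → B ⊆ B' → A ⊢ B → A' ⊢ B'
      cut : ∀ {A B} c → A ⊢ (B ⁺++⁺ [ c ]) → (A ⁺++⁺ [ c ]) ⊢ B → A ⊢ B

  record IsRegularEntailment {r : Level} (_⊢_ : Fe → Fe → Set r) : Set (c ⊔ ℓ ⊔ r) where
    field
      isEntailment : IsEntailment _⊢_
      order⇒ : ∀ {a b} → a ≤ b → [ a ] ⊢ [ b ]
      translation : ∀ {A B} x → A ⊢ B → (x +ˢ A) ⊢ (x +ˢ B)
      exchange : ∀ a b x y →
        ([ x + a ] ⁺++⁺ [ y + b ]) ⊢ ([ y + a ] ⁺++⁺ [ x + b ])

  Rel-y : {r : Level} → (Fe → Fe → Set r) → Carrier → Fe → Fe → Set (r)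
  Rel-y _⊢_ y A B = Σ ℕ (λ p → (A ⁺++⁺ ((p · y) +ˢ A)) ⊢ B)

-- For u v : G write 0 ≤ u ∨ v when a , b ⊢ u + a , v + b for all a b.  The exchange
-- axiom gives 0 ≤ x ∨ (- x), and cut makes the relation additive in each argument, so
-- 0 ≤ p x ∨ q (- x) for all p q.  Hence A ⊢ B , u + a , v + a' for all a a' ∈ A, and
-- cutting against A , v + A ⊢ B and then against A , u + A ⊢ B yields A ⊢ B.
module Submission where

open import Defs hiding (_⊆_)
open import Level using (Level; _⊔_)
open import Data.Nat using (zero; suc)
open import Data.Product using (_,_)
open import Data.List using (List; []; _∷_; _++_)
open import Data.List.Properties using (++-assoc; ++-identityʳ)
open import Data.List.NonEmpty using ([_]; toList; _⁺++⁺_)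
open import Data.List.Membership.Propositional using (_∈_)
open import Data.List.Membership.Propositional.Properties using (∈-map⁻)
open import Data.List.Relation.Unary.Any using (here; there)
open import Data.List.Relation.Binary.Subset.Propositional using (_⊆_)
open import Data.List.Relation.Binary.Subset.Propositional.Properties
  using (⊆-refl; ⊆-trans; ⊆-reflexive; xs⊆xs++ys; xs⊆ys++xs; ++⁺ˡ; ∈-∷⁺ʳ)
open import Relation.Binary.PropositionalEquality using (refl; sym)
open import Algebra.Bundles using (Group)
open import Algebra.Structures using (IsAbelianGroup)
import Algebra.Properties.Group as GroupProperties

pair⊆ : ∀ {a} {A : Set a} {x y : A} {zs : List A} → x ∈ zs → y ∈ zs → x ∷ y ∷ [] ⊆ zs
pair⊆ x∈zs y∈zs = ∈-∷⁺ʳ x∈zs (∈-∷⁺ʳ y∈zs (λ ()))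

module _ {c ℓ r : Level} (G : OrderedGroup c ℓ) {_⊢_ : Fe G → Fe G → Set r} where
  open OrderedGroup G

  module _ (ent : IsEntailment G _⊢_) where
    open IsEntailment ent

    multicut : ∀ (C : List Carrier) {Γ Γ′ Δ} →
               (∀ {d} → d ∈ C → Γ ⊢ (Δ ⁺++⁺ [ d ])) →
               toList Γ′ ⊆ toList Γ ++ C → Γ′ ⊢ Δ → Γ ⊢ Δ
    multicut [] {Γ} _ Γ′⊆Γ Γ′⊢Δ =
      monotonicity (⊆-trans Γ′⊆Γ (⊆-reflexive (++-identityʳ (toList Γ)))) ⊆-refl Γ′⊢Δ
    multicut (d ∷ C) {Γ} Γ⊢Δ,C Γ′⊆Γ,d,C Γ′⊢Δ =
      cut d (Γ⊢Δ,C (here refl))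
        (multicut C (λ e∈C → monotonicity (xs⊆xs++ys _ _) ⊆-refl (Γ⊢Δ,C (there e∈C)))
          (⊆-trans Γ′⊆Γ,d,C (⊆-reflexive (sym (++-assoc (toList Γ) (d ∷ []) C))))
          Γ′⊢Δ)

  module _ (reg : IsRegularEntailment G _⊢_) where
    open IsRegularEntailment reg
    open IsEntailment isEntailment
    open IsAbelianGroup isAbelianGroup using (assoc; identityˡ; isGroup)

    private
      group : Group c c
      group = record { isGroup = isGroup }

    open GroupProperties group using (\\-leftDividesˡ)

    -- In the lattice-ordered group presented by ⊢ this says 0 ≤ u ∨ v.
    0≤_∨_ : Carrier → Carrier → Set (c ⊔ r)
    0≤ u ∨ v = ∀ a b → ([ a ] ⁺++⁺ [ b ]) ⊢ ([ u + a ] ⁺++⁺ [ v + b ])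

    0≤∨-sym : ∀ {u v} → 0≤ u ∨ v → 0≤ v ∨ u
    0≤∨-sym 0≤u∨v a b = monotonicity (pair⊆ (there (here refl)) (here refl))
                          (pair⊆ (there (here refl)) (here refl)) (0≤u∨v b a)

    0≤0∨ : ∀ v → 0≤ 0# ∨ v
    0≤0∨ v a b = monotonicity (xs⊆xs++ys _ _) (∈-∷⁺ʳ (here (sym (identityˡ a))) (λ ()))
                   (reflexivity a)

    0≤∨- : ∀ u → 0≤ u ∨ (- u)
    0≤∨- u a b = monotonicity (pair⊆ (here (identityˡ a)) (there (here (\\-leftDividesˡ u b))))
                   (pair⊆ (here refl) (there (here (identityˡ (- u + b)))))
                   (exchange a (- u + b) 0# u)

    0≤∨-+ˡ : ∀ {u v w} → 0≤ u ∨ v → 0≤ w ∨ v → 0≤ (w + u) ∨ v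
    0≤∨-+ˡ {u} {v} {w} 0≤u∨v 0≤w∨v a b = cut (u + a)
      (monotonicity ⊆-refl (pair⊆ (there (there (here refl))) (there (here refl))) (0≤u∨v a b))
      (monotonicity (pair⊆ (there (there (here refl))) (there (here refl)))
                    (pair⊆ (here (sym (assoc w u a))) (there (here refl)))
                    (0≤w∨v (u + a) b))

    0≤∨-·ˡ : ∀ {u v} p → 0≤ u ∨ v → 0≤ _·_ G p u ∨ v
    0≤∨-·ˡ zero    _     = 0≤0∨ _
    0≤∨-·ˡ (suc p) 0≤u∨v = 0≤∨-+ˡ (0≤∨-·ˡ p 0≤u∨v) 0≤u∨v

    0≤∨-· : ∀ {u v} p q → 0≤ u ∨ v → 0≤ _·_ G p u ∨ _·_ G q v
    0≤∨-· p q 0≤u∨v = 0≤∨-·ˡ p (0≤∨-sym (0≤∨-·ˡ q (0≤∨-sym 0≤u∨v)))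

    cut-translates : ∀ {u v A B} → 0≤ u ∨ v →
                     (A ⁺++⁺ _+ˢ_ G u A) ⊢ B → (A ⁺++⁺ _+ˢ_ G v A) ⊢ B → A ⊢ B
    cut-translates {u} {v} {A} {B} 0≤u∨v A,u+A⊢B A,v+A⊢B =
      multicut isEntailment (toList (_+ˢ_ G u A)) A⊢B,u+A ⊆-refl A,u+A⊢B
      where
      A⊢B,u+a,v+A : ∀ {a d} → a ∈ toList A → d ∈ toList (_+ˢ_ G v A) →
                    A ⊢ ((B ⁺++⁺ [ u + a ]) ⁺++⁺ [ d ])
      A⊢B,u+a,v+A {a} a∈A d∈v+A with ∈-map⁻ (v +_) d∈v+A
      ... | a′ , a′∈A , refl =
        monotonicity (pair⊆ a∈A a′∈A) (++⁺ˡ (v + a′ ∷ []) (xs⊆ys++xs (u + a ∷ []) (toList B)))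
          (0≤u∨v a a′)

      A⊢B,u+A : ∀ {d} → d ∈ toList (_+ˢ_ G u A) → A ⊢ (B ⁺++⁺ [ d ])
      A⊢B,u+A d∈u+A with ∈-map⁻ (u +_) d∈u+A
      ... | a , a∈A , refl =
        multicut isEntailment (toList (_+ˢ_ G v A)) (A⊢B,u+a,v+A a∈A) ⊆-refl
          (monotonicity ⊆-refl (xs⊆xs++ys _ _) A,v+A⊢B)

theorem2p11 : {c ℓ r : Level} (G : OrderedGroup c ℓ) →
    (_⊢_ : Fe G → Fe G → Set r) →
    IsRegularEntailment G _⊢_ →
    (x : OrderedGroup.Carrier G) (A B : Fe G) →
    Rel-y G _⊢_ x A B →
    Rel-y G _⊢_ (OrderedGroup.-_ G x) A B →
    A ⊢ B
theorem2p11 G _⊢_ reg x A B (p , A,px+A⊢B) (q , A,q-x+A⊢B) =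
  cut-translates G reg (0≤∨-· G reg p q (0≤∨- G reg x)) A,px+A⊢B A,q-x+A⊢B
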